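{- Let $G=(X,E)$ be a symmetric 2-structure, $\mathcal{I}$ an involution of its colours without fixed point, and let $U,V$ be two crossing involution modules of $G$. Then $U\setminus V$ is an involution module of $G$.
   Context: A (symmetric) 2-structure is a pair $G=(X,E)$ with $X$ finite and $E:X^2\to\mathbb{N}$ symmetric; its colour set is $C=\{E(u,v):u\neq v\}$. For $s\in X$, $i\in C$, $X'\subseteq X$, $N^i_s(X')=\{x\in X':E(s,x)=i\}$. Given an involution $\mathcal{I}$ of $C$ without fixed point, $U\subseteq X$ is an involution module if for all $u,v\in U$, either $N^i_u(X\setminus U)=N^{\mathcal{I}(i)}_v(X\setminus U)$ for all $i\in C$, or $N^i_u(X\setminus U)=N^{i}_v(X\setminus U)$ for all $i\in C$. Two sets $A,B\subseteq X$ are crossing if $A\cap B$, $A\setminus B$, $B\setminus A$ are all nonempty and $A\cup B\neq X$. -}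

module Defs where

open import Data.Nat using (ℕ)
open import Data.Fin using (Fin)
open import Data.Fin.Subset using (Subset; _∈_; _∉_; _∩_; _─_; Nonempty)
open import Data.Product using (Σ; ∃; _×_)
open import Data.Sum using (_⊎_)
open import Function.Bundles using (_⇔_)
open import Relation.Binary.PropositionalEquality using (_≡_; _≢_)

-- A 2-structure on X = Fin n is given by E : Fin n → Fin n → ℕ.
Symmetric : {n : ℕ} → (Fin n → Fin n → ℕ) → Set
Symmetric E = ∀ u v → E u v ≡ E v u

IsColour : {n : ℕ} → (Fin n → Fin n → ℕ) → ℕ → Set
IsColour {n} E i = Σ (Fin n) λ u → Σ (Fin n) λ v → u ≢ v × E u v ≡ i

-- 𝓘 : ℕ → ℕ restricted to C is an involution of C without fixed point
-- (values of 𝓘 outside C are irrelevant).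
FixedPointFreeInvolution : {n : ℕ} → (Fin n → Fin n → ℕ) → (ℕ → ℕ) → Set
FixedPointFreeInvolution E 𝓘 =
  ∀ i → IsColour E i → IsColour E (𝓘 i) × 𝓘 (𝓘 i) ≡ i × 𝓘 i ≢ i

SameNbhd : {n : ℕ} → (Fin n → Fin n → ℕ) → Subset n →
           Fin n → ℕ → Fin n → ℕ → Set
SameNbhd E U u i v j = ∀ x → x ∉ U → (E u x ≡ i ⇔ E v x ≡ j)

IsInvolutionModule : {n : ℕ} → (Fin n → Fin n → ℕ) → (ℕ → ℕ) → Subset n → Set
IsInvolutionModule E 𝓘 U =
  ∀ u v → u ∈ U → v ∈ U →
    (∀ i → IsColour E i → SameNbhd E U u i v (𝓘 i))
    ⊎ (∀ i → IsColour E i → SameNbhd E U u i v i)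

Crossing : {n : ℕ} → Subset n → Subset n → Set
Crossing A B =
  Nonempty (A ∩ B) × Nonempty (A ─ B) × Nonempty (B ─ A)
  × ∃ λ x → x ∉ A × x ∉ B

-- Between two vertices u, v of an involution module U the colours towards the
-- outside of U are related by a fixed twist g ∈ {𝓘, id}: E v x = g (E u x).
-- For u, v ∈ U ∖ V it remains to check the vertices x ∈ U ∩ V, which lie
-- outside V. Pick w ∈ V ∖ U; the module V relates w and x by a twist f, and
-- walking around the square u–w–v–x with symmetry of E gives
--   E v x = f (E w v) = f (g (E u w)) = g (f (E w u)) = g (E u x),
-- since any two twists commute.
module Submission where

open import Defs
open import Data.Nat using (ℕ)
open import Data.Fin using (Fin; zero)
open import Data.Fin.Subset using (Subset; _─_; _∈_; _∉_; inside; outside)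
open import Data.Fin.Subset.Properties using (_∈?_; drop-there; p─q⊆p; x∈p∧x∉q⇒x∈p─q)
open import Data.Vec using (_∷_; here; there)
open import Data.Product using (∃; _×_; _,_; proj₁; proj₂)
open import Data.Sum using (inj₁; inj₂)
open import Function using (id; _∘_)
open import Function.Bundles using (mk⇔; Equivalence)
open import Relation.Binary.PropositionalEquality
open import Relation.Nullary using (yes; no)

private
  variable
    n : ℕ

x∈p─q⇒x∉q : {x : Fin n} (p q : Subset n) → x ∈ p ─ q → x ∉ q
x∈p─q⇒x∉q              (inside  ∷ p) (outside ∷ q) here      ()
x∈p─q⇒x∉q {x = zero} (outside ∷ p) (inside  ∷ q) ()
x∈p─q⇒x∉q {x = zero} (outside ∷ p) (outside ∷ q) ()
x∈p─q⇒x∉q              (_       ∷ p) (_       ∷ q) (there m) x∈q = x∈p─q⇒x∉q p q m (drop-there x∈q)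

∈⇒∉⇒≢ : {A : Subset n} {a b : Fin n} → a ∈ A → b ∉ A → a ≢ b
∈⇒∉⇒≢ a∈A b∉A refl = b∉A a∈A

data Twist (𝓘 : ℕ → ℕ) : (ℕ → ℕ) → Set where
  twisted  : Twist 𝓘 𝓘
  straight : Twist 𝓘 id

twists-commute : ∀ {𝓘 f g} → Twist 𝓘 f → Twist 𝓘 g → ∀ c → f (g c) ≡ g (f c)
twists-commute twisted  twisted  c = refl
twists-commute twisted  straight c = refl
twists-commute straight twisted  c = refl
twists-commute straight straight c = refl

module _ {n : ℕ} (E : Fin n → Fin n → ℕ) where

  Transforms : Subset n → Fin n → Fin n → (ℕ → ℕ) → Set
  Transforms U u v g = ∀ x → x ∉ U → E v x ≡ g (E u x)

  InjectiveOnColours : (ℕ → ℕ) → Set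
  InjectiveOnColours g = ∀ {i j} → IsColour E i → IsColour E j → g i ≡ g j → i ≡ j

  involution-injectiveOnColours : ∀ {𝓘} → FixedPointFreeInvolution E 𝓘 →
                                  InjectiveOnColours 𝓘
  involution-injectiveOnColours {𝓘} inv {i} {j} ci cj 𝓘i≡𝓘j = begin
    i         ≡⟨ proj₁ (proj₂ (inv i ci)) ⟨
    𝓘 (𝓘 i)  ≡⟨ cong 𝓘 𝓘i≡𝓘j ⟩
    𝓘 (𝓘 j)  ≡⟨ proj₁ (proj₂ (inv j cj)) ⟩
    j         ∎
    where open ≡-Reasoning

  twist-injectiveOnColours : ∀ {𝓘 g} → FixedPointFreeInvolution E 𝓘 →
                             Twist 𝓘 g → InjectiveOnColours g
  twist-injectiveOnColours inv twisted  = involution-injectiveOnColours inv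
  twist-injectiveOnColours inv straight _ _ = id

  sameNbhd⇒transforms : ∀ {U u v g} → u ∈ U →
                        (∀ i → IsColour E i → SameNbhd E U u i v (g i)) →
                        Transforms U u v g
  sameNbhd⇒transforms u∈U same x x∉U =
    Equivalence.to (same _ (_ , x , ∈⇒∉⇒≢ u∈U x∉U , refl) x x∉U) refl

  transforms⇒sameNbhd : ∀ {U u v g} → u ∈ U → InjectiveOnColours g →
                        Transforms U u v g →
                        ∀ i → IsColour E i → SameNbhd E U u i v (g i)
  transforms⇒sameNbhd u∈U inj t i ci x x∉U = mk⇔
    (λ Eux≡i → trans (t x x∉U) (cong _ Eux≡i))
    (λ Evx≡gi → inj (_ , x , ∈⇒∉⇒≢ u∈U x∉U , refl) ci (trans (sym (t x x∉U)) Evx≡gi))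

  Related : (ℕ → ℕ) → Subset n → Fin n → Fin n → Set
  Related 𝓘 U u v = ∃ λ g → Twist 𝓘 g × Transforms U u v g

  isInvolutionModule⇒related : ∀ {𝓘 U u v} → IsInvolutionModule E 𝓘 U →
                               u ∈ U → v ∈ U → Related 𝓘 U u v
  isInvolutionModule⇒related modU u∈U v∈U with modU _ _ u∈U v∈U
  ... | inj₁ same = _ , twisted  , sameNbhd⇒transforms u∈U same
  ... | inj₂ same = _ , straight , sameNbhd⇒transforms u∈U same

  related⇒isInvolutionModule : ∀ {𝓘 U} → FixedPointFreeInvolution E 𝓘 →
                               (∀ {u v} → u ∈ U → v ∈ U → Related 𝓘 U u v) →
                               IsInvolutionModule E 𝓘 U
  related⇒isInvolutionModule inv rel u v u∈U v∈U with rel u∈U v∈U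
  ... | _ , twisted  , t = inj₁ (transforms⇒sameNbhd u∈U (twist-injectiveOnColours inv twisted)  t)
  ... | _ , straight , t = inj₂ (transforms⇒sameNbhd u∈U (twist-injectiveOnColours inv straight) t)

  module _ (symmetric : Symmetric E) where

    transforms-across : ∀ {U V u v w x f g} → (∀ c → f (g c) ≡ g (f c)) →
                        u ∉ V → v ∉ V → w ∉ U →
                        Transforms U u v g → Transforms V w x f →
                        E v x ≡ g (E u x)
    transforms-across {u = u} {v} {w} {x} {f} {g} commute u∉V v∉V w∉U tU tV = begin
      E v x          ≡⟨ symmetric v x ⟩
      E x v          ≡⟨ tV v v∉V ⟩
      f (E w v)      ≡⟨ cong f (symmetric w v) ⟩
      f (E v w)      ≡⟨ cong f (tU w w∉U) ⟩
      f (g (E u w))  ≡⟨ commute (E u w) ⟩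
      g (f (E u w))  ≡⟨ cong (g ∘ f) (symmetric u w) ⟩
      g (f (E w u))  ≡⟨ cong g (tV u u∉V) ⟨
      g (E x u)      ≡⟨ cong g (symmetric x u) ⟩
      g (E u x)      ∎
      where open ≡-Reasoning

    transforms-─ : ∀ {𝓘 U V u v w g} → IsInvolutionModule E 𝓘 V → Twist 𝓘 g →
                   u ∈ U ─ V → v ∈ U ─ V → w ∈ V ─ U →
                   Transforms U u v g → Transforms (U ─ V) u v g
    transforms-─ {U = U} {V} {g = g} modV tw u∈U─V v∈U─V w∈V─U tU x x∉U─V with x ∈? V
    ... | yes x∈V =
      let f , twf , tV = isInvolutionModule⇒related modV (p─q⊆p V U w∈V─U) x∈V
      in transforms-across {f = f} {g} (twists-commute twf tw)
           (x∈p─q⇒x∉q U V u∈U─V) (x∈p─q⇒x∉q U V v∈U─V) (x∈p─q⇒x∉q V U w∈V─U) tU tV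
    ... | no x∉V = tU x λ x∈U → x∉U─V (x∈p∧x∉q⇒x∈p─q x∈U x∉V)

mainTheorem4 : (n : ℕ) (E : Fin n → Fin n → ℕ) (𝓘 : ℕ → ℕ) (U V : Subset n) →
    Symmetric E → FixedPointFreeInvolution E 𝓘 →
    IsInvolutionModule E 𝓘 U → IsInvolutionModule E 𝓘 V → Crossing U V →
    IsInvolutionModule E 𝓘 (U ─ V)
mainTheorem4 n E 𝓘 U V symmetric inv modU modV (_ , _ , (_ , w∈V─U) , _) =
  related⇒isInvolutionModule E inv λ u∈U─V v∈U─V →
    let g , tw , tU = isInvolutionModule⇒related E modU (p─q⊆p U V u∈U─V) (p─q⊆p U V v∈U─V)
    in g , tw , transforms-─ E symmetric modV tw u∈U─V v∈U─V w∈V─U tU
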